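{- The algorithm $\mathtt{Follow}$ correctly solves the ideal patient zero problem: for every simple temporal graph $\mathcal{G}$ with lifetime $T_{\max}$ and every $\delta\in\mathbb{N}^+$, after performing the rounds of $\mathtt{Follow}$ (whatever consistent infection logs the Adversary returns), the Discoverer can correctly decide whether an IPZ pair exists and, if one exists, output an IPZ pair, thereby winning the ideal patient zero game.
   Context: A simple temporal graph $\mathcal{G}=(V,E,\lambda)$ with lifetime $T_{\max}$ has a finite undirected static graph $(V,E)$ and labeling $\lambda:E\to\{1,\dots,T_{\max}\}$. Infection model with parameter $\delta$: all nodes start susceptible; a seed infection $(v,t)$ makes $v$ infected at time $t$; otherwise a susceptible node $u$ becomes infected at time $t$ iff some node $w$ infectious at time $t$ has an edge $uw$ with $\lambda(uw)=t$ (if several, exactly one infects $u$); a node infected at time $t$ is infectious at times $t+1,\dots,t+\delta$ and resistant afterwards. An infection log lists triples $(u,w,s)$ ($u$ infected $w$ at time $s$; seeds as $(u,u,s)$); it is consistent with a seed set if some infection chain with those seeds produces it. $(v,t)$ is an IPZ pair if seed-infecting only $\{(v,t)\}$ causes every node to become infected. IPZ game: the Discoverer learns $V$ and $E$; each round it submits seed infections and the Adversary answers with a consistent infection log; at the end the Discoverer submits a pair $(u,t)$ or $\bot$; the Adversary responds with a temporal graph consistent with all logs, and wins if the submitted pair is not an IPZ pair, or if $\bot$ was submitted though an IPZ pair exists; otherwise the Discoverer wins. Subroutine $\mathtt{Explore}(u,t)$: (1) for each $t'\in\{t-\delta-1,t-1,t\}$, if no round with seed infection $(u,t')$ has been performed,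 perform a round with the single seed $(u,t')$ and record it; (2) for each edge $uw$ along which $u$ newly infected $w$ in these rounds, at time $s$, call $\mathtt{Explore}(w,s)$. Algorithm $\mathtt{Follow}$: pick $v_0\in V$ arbitrarily; for each $i\in\{0,\dots,\lceil T_{\max}/\delta\rceil\}$ perform a round with the single seed $(v_0,i\delta)$; for each edge $e=v_0u$ along which an infection succeeded, call $\mathtt{Explore}(u,\lambda(e))$. -}

module Defs where

open import Data.Nat as ℕ using (ℕ; zero; suc; _∸_; NonZero)
open import Data.Integer as ℤ using (ℤ; +_; _-_; _<_; _≤_)
open import Data.Fin using (Fin; _≟_)
open import Data.Bool using (Bool; true; false)
open import Data.Maybe using (Maybe; just; nothing)
open import Data.Product using (Σ; ∃; ∃-syntax; _×_; _,_; proj₁; proj₂)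
open import Data.Sum using (_⊎_)
open import Data.List using (List; []; _∷_; _++_; map; length; drop; upTo)
open import Data.List.Membership.Propositional using (_∈_; _∉_)
open import Relation.Nullary using (¬_; yes; no)
open import Relation.Binary.PropositionalEquality using (_≡_; _≢_)

record SimpleGraph (n : ℕ) : Set where
  field
    adj    : Fin n → Fin n → Bool
    sym    : ∀ i j → adj i j ≡ adj j i
    irrefl : ∀ i → adj i i ≡ false

open SimpleGraph public

Edge : ∀ {n} → SimpleGraph n → Fin n → Fin n → Set
Edge E u w = adj E u w ≡ true

-- A labeling λ : E → {1, …, Tmax}  (one label per edge: simple temporal
-- graph).  Values of 'lab' on non-edges are never used.
record Labeling {n : ℕ} (E : SimpleGraph n) (Tmax : ℕ) : Set where
  field
    lab      : Fin n → Fin n → ℕ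
    lab-sym  : ∀ u w → Edge E u w → lab u w ≡ lab w u
    lab-pos  : ∀ u w → Edge E u w → 1 ℕ.≤ lab u w
    lab-life : ∀ u w → Edge E u w → lab u w ℕ.≤ Tmax

open Labeling public

-- Infection model with parameter δ.  Times are integers (seed times
-- t - δ - 1 may be negative).  An infection-time function
-- τ : V → Maybe ℤ  (nothing = never infected).

module Model {n : ℕ} (E : SimpleGraph n) {Tmax : ℕ} (L : Labeling E Tmax) (δ : ℕ) where

  InfectsAt : (Fin n → Maybe ℤ) → Fin n → Fin n → ℤ → Set
  InfectsAt τ u w t =
    Σ ℤ λ s → τ u ≡ just s × s < t × t ≤ s ℤ.+ + δ × Edge E u w × + lab L u w ≡ t

  Infectable : (Fin n → Maybe ℤ) → Fin n → ℤ → Set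
  Infectable τ w t = ∃[ u ] InfectsAt τ u w t

  InfSpec : Fin n → ℤ → (Fin n → Maybe ℤ) → Set
  InfSpec v t₀ τ =
    τ v ≡ just t₀ ×
    (∀ u → u ≢ v → ∀ t → τ u ≡ just t →
        Infectable τ u t × (∀ t' → Infectable τ u t' → t ≤ t')) ×
    (∀ u → u ≢ v → ∀ t → Infectable τ u t → ∃[ t' ] τ u ≡ just t')

  -- Infection logs: triples (u , w , s) = "u infected w at time s";
  -- the seed appears as (v , v , t₀).
  Log : Set
  Log = List (Fin n × Fin n × ℤ)

  Produces : Fin n → ℤ → (Fin n → Maybe ℤ) → Log → Set
  Produces v t₀ τ lg =
    Σ (Fin n → Fin n) λ par →
      (∀ w → w ≢ v → ∀ s → τ w ≡ just s → InfectsAt τ (par w) w s) ×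
      (∀ a b s → (a , b , s) ∈ lg →
         (a ≡ v × b ≡ v × s ≡ t₀) ⊎ (b ≢ v × τ b ≡ just s × a ≡ par b)) ×
      (∀ a b s → ((a ≡ v × b ≡ v × s ≡ t₀) ⊎ (b ≢ v × τ b ≡ just s × a ≡ par b)) →
         (a , b , s) ∈ lg)

  Consistent : Fin n × ℤ → Log → Set
  Consistent (v , t₀) lg = Σ (Fin n → Maybe ℤ) λ τ → InfSpec v t₀ τ × Produces v t₀ τ lg

  IPZ : Fin n → ℤ → Set
  IPZ v t = Σ (Fin n → Maybe ℤ) λ τ → InfSpec v t τ × (∀ w → ∃[ s ] τ w ≡ just s)

  Wins : Maybe (Fin n × ℤ) → Set
  Wins (just (u , t)) = IPZ u t
  Wins nothing        = ¬ (Σ (Fin n) λ u → Σ ℤ λ t → IPZ u t)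

-- The algorithm Follow, as a big-step relation on transcripts.  The
-- Discoverer only knows V = Fin n and E; the answers (logs) of the
-- Adversary are arbitrary at each round (constrained only at the end,
-- by consistency with the final temporal graph).

RawLog : ℕ → Set
RawLog n = List (Fin n × Fin n × ℤ)

Round : ℕ → Set
Round n = (Fin n × ℤ) × RawLog n

Hist : ℕ → Set
Hist n = List (Round n)

seeds : ∀ {n} → Hist n → List (Fin n × ℤ)
seeds = map proj₁

infectedBy : ∀ {n} → Fin n → RawLog n → List (Fin n × ℤ)
infectedBy u [] = []
infectedBy u ((a , w , s) ∷ lg) with a ≟ u | w ≟ u
... | yes _ | no _ = (w , s) ∷ infectedBy u lg
... | _     | _    = infectedBy u lg

children : ∀ {n} → Fin n → Hist n → List (Fin n × ℤ)
children u [] = []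
children u ((_ , lg) ∷ rs) = infectedBy u lg ++ children u rs

ceilDiv : (a δ : ℕ) .{{_ : NonZero δ}} → ℕ
ceilDiv a δ = (a ℕ.+ (δ ∸ 1)) ℕ./ δ

module Algorithm {n : ℕ} (E : SimpleGraph n) (Tmax δ : ℕ) where

  data Step1 (u : Fin n) : Hist n → List ℤ → Hist n → Set where
    done  : ∀ {H} → Step1 u H [] H
    skip  : ∀ {H t' ts H'} → (u , t') ∈ seeds H → Step1 u H ts H' → Step1 u H (t' ∷ ts) H'
    query : ∀ {H t' ts H'} → (u , t') ∉ seeds H → (lg : RawLog n) →
            Step1 u (H ++ ((u , t') , lg) ∷ []) ts H' → Step1 u H (t' ∷ ts) H'

  mutual
    data Explore : Hist n → Fin n × ℤ → Hist n → Set where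
      explore : ∀ {H u t H₁ H₂} →
        Step1 u H ((t - + δ - + 1) ∷ (t - + 1) ∷ t ∷ []) H₁ →
        ExploreAll H₁ (children u (drop (length H) H₁)) H₂ →
        Explore H (u , t) H₂

    data ExploreAll : Hist n → List (Fin n × ℤ) → Hist n → Set where
      []  : ∀ {H} → ExploreAll H [] H
      _∷_ : ∀ {H c cs H₁ H₂} → Explore H c H₁ → ExploreAll H₁ cs H₂ →
            ExploreAll H (c ∷ cs) H₂

  data Rounds (v₀ : Fin n) : Hist n → List ℤ → Hist n → Set where
    done  : ∀ {H} → Rounds v₀ H [] H
    query : ∀ {H t ts H'} → (lg : RawLog n) →
            Rounds v₀ (H ++ ((v₀ , t) , lg) ∷ []) ts H' → Rounds v₀ H (t ∷ ts) H'

  data FollowRun (v₀ : Fin n) .{{_ : NonZero δ}} : Hist n → Set where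
    follow : ∀ {H₀ H} →
      Rounds v₀ [] (map (λ i → + (i ℕ.* δ)) (upTo (suc (ceilDiv Tmax δ)))) H₀ →
      ExploreAll H₀ (children v₀ H₀) H →
      FollowRun v₀ H

{-# OPTIONS --safe #-}
-- Call (w , s) explored when the rounds seeded at s - δ - 1, s - 1 and s have been performed. A round
-- seeded at t logs the infection along the first edge of its seed active in the window (t , t + δ], and
-- every infection logged during Follow gets explored; hence exploration propagates along edges, starting
-- from v₀, whose initial rounds cover every label. If (v , t) is an IPZ pair, following v₀'s infection
-- chain back to v shows that v is explored at the first label active for t, and from there a round
-- seeded with v is performed whose window holds exactly the same edges of v as that of t. The process
-- depends only on those edges, so that round's log infects every node. Conversely a log infecting every
-- node witnesses an IPZ pair, so the Discoverer answers with the seed of the first such round, or ⊥.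
module Submission where

open import Defs hiding (sym)
open import Data.Nat as ℕ using (ℕ; zero; suc; NonZero; z≤n; s≤s; >-nonZero⁻¹)
import Data.Nat.Properties as ℕP
open import Data.Nat.DivMod using (_/_; _%_; m≡m%n+[m/n]*n; m%n<n; m/n*n≤m; /-monoˡ-≤)
open import Data.Nat.Induction using (<-rec)
open import Data.Integer as ℤ using (ℤ; +_; _-_; _+_; -_; _<_; _≤_; pred; +<+; +≤+)
import Data.Integer.Properties as ℤP
open import Data.Integer.Tactic.RingSolver using (solve-∀)
open import Data.Fin using (Fin; _≟_)
import Data.Fin.Properties as FinP
open import Data.Bool using (true)
import Data.Bool.Properties as BoolP
open import Data.Maybe using (Maybe; just; nothing)
open import Data.Maybe.Properties using (just-injective)
open import Data.Product using (Σ; Σ-syntax; ∃; ∃-syntax; _×_; _,_; proj₁; proj₂)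
open import Data.Sum using (_⊎_; inj₁; inj₂)
open import Data.Empty using (⊥-elim)
open import Data.List using (List; []; _∷_; _++_; length; drop)
open import Data.List.Properties using (map-++; ++-assoc; ++-identityʳ)
open import Data.List.Membership.Propositional using (_∈_; find; lose)
open import Data.List.Membership.Propositional.Properties using (∈-++⁺ˡ; ∈-++⁺ʳ; ∈-map⁺; ∈-map⁻; ∈-upTo⁺)
open import Data.List.Relation.Unary.All as All using (All; []; _∷_)
open import Data.List.Relation.Unary.All.Properties using (++⁺; ++⁻)
open import Data.List.Relation.Unary.Any as Any using (Any; here; there)
open import Function using (_∘_)
open import Relation.Nullary using (¬_; Dec; yes; no)
open import Relation.Nullary.Decidable using (_×-dec_)
open import Relation.Unary using (Pred; Decidable; _⊆_; _≐_)
open import Relation.Binary.PropositionalEquality using (_≡_; _≢_; refl; sym; trans; cong; subst)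

i-1≡pred[i] : ∀ i → i - + 1 ≡ pred i
i-1≡pred[i] i = ℤP.+-comm i (- + 1)

i-1<j⇒i≤j : ∀ {i j} → i - + 1 < j → i ≤ j
i-1<j⇒i≤j {i} p = subst (_≤ _) (ℤP.suc-pred i) (ℤP.i<j⇒suc[i]≤j (subst (_< _) (i-1≡pred[i] i) p))

i≤j⇒i-1<j : ∀ {i j} → i ≤ j → i - + 1 < j
i≤j⇒i-1<j {i} p = subst (_< _) (sym (i-1≡pred[i] i)) (ℤP.<-≤-trans (ℤP.i≤pred[j]⇒i<j ℤP.≤-refl) p)

i≤j-1⇒i<j : ∀ {i j} → i ≤ j - + 1 → i < j
i≤j-1⇒i<j {j = j} p = ℤP.i≤pred[j]⇒i<j (subst (_ ≤_) (i-1≡pred[i] j) p)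

i<j⇒i≤j-1 : ∀ {i j} → i < j → i ≤ j - + 1
i<j⇒i≤j-1 {j = j} p = subst (_ ≤_) (sym (i-1≡pred[i] j)) (ℤP.i<j⇒i≤pred[j] p)

i-k≤j⇒i≤j+k : ∀ {i j} k → i - k ≤ j → i ≤ j + k
i-k≤j⇒i≤j+k {i} k p = subst (_≤ _) (lemma i k) (ℤP.+-monoˡ-≤ k p)
  where lemma : ∀ i k → i - k + k ≡ i
        lemma = solve-∀

i≤j+k⇒i-k≤j : ∀ {i j} k → i ≤ j + k → i - k ≤ j
i≤j+k⇒i-k≤j {j = j} k p = subst (_ ≤_) (lemma j k) (ℤP.+-monoˡ-≤ (- k) p)
  where lemma : ∀ j k → j + k - k ≡ j
        lemma = solve-∀

i<j+suc[m]⇒i≤j+m : ∀ {i j m} → i < j + + suc m → i ≤ j + + m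
i<j+suc[m]⇒i≤j+m {i} {j} {m} p = subst (i ≤_) (lemma j (+ m)) (ℤP.i<j⇒i≤pred[j] p)
  where lemma : ∀ j m → - + 1 + (j + (+ 1 + m)) ≡ j + m
        lemma = solve-∀

i<j⇒i+suc[m]≤j+m : ∀ {i j} m → i < j → i + + suc m ≤ j + + m
i<j⇒i+suc[m]≤j+m {i} m p =
  subst (_≤ _) (lemma i (+ m)) (ℤP.+-monoˡ-≤ (+ m) (ℤP.i<j⇒suc[i]≤j p))
  where lemma : ∀ i m → + 1 + i + m ≡ i + (+ 1 + m)
        lemma = solve-∀

+-cancelʳ-< : ∀ {i j} k → i + k < j + k → i < j
+-cancelʳ-< {i} {j} k i+k<j+k with i ℤP.<? j
... | yes i<j = i<j
... | no i≮j = ⊥-elim (ℤP.<⇒≱ i+k<j+k (ℤP.+-monoˡ-≤ k (ℤP.≮⇒≥ i≮j)))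

initial-window : ∀ {δ} .{{_ : NonZero δ}} {ℓ T} → 1 ℕ.≤ ℓ → ℓ ℕ.≤ T →
  ∃[ i ] i ℕ.< suc (ceilDiv T δ) × i ℕ.* δ ℕ.< ℓ × ℓ ℕ.≤ i ℕ.* δ ℕ.+ δ
initial-window {δ} {suc q} {T} (s≤s z≤n) ℓ≤T =
  q / δ , s≤s (/-monoˡ-≤ δ q≤T+δ-1) , s≤s (m/n*n≤m q δ) , q<q/δ*δ+δ
  where
  q≤T+δ-1 : q ℕ.≤ T ℕ.+ (δ ℕ.∸ 1)
  q≤T+δ-1 = ℕP.≤-trans (ℕP.n≤1+n q) (ℕP.≤-trans ℓ≤T (ℕP.m≤m+n T _))
  q<q/δ*δ+δ : q ℕ.< q / δ ℕ.* δ ℕ.+ δ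
  q<q/δ*δ+δ = begin-strict
    q                     ≡⟨ m≡m%n+[m/n]*n q δ ⟩
    q % δ ℕ.+ q / δ ℕ.* δ <⟨ ℕP.+-monoˡ-< (q / δ ℕ.* δ) (m%n<n q δ) ⟩
    δ ℕ.+ q / δ ℕ.* δ     ≡⟨ ℕP.+-comm δ _ ⟩
    q / δ ℕ.* δ ℕ.+ δ     ∎
    where open ℕP.≤-Reasoning

Least : ∀ {m p} → Pred (Fin m) p → (Fin m → ℕ) → Pred (Fin m) _
Least P f y = P y × (∀ {z} → P z → f y ℕ.≤ f z)

min-witness : ∀ {m p} {P : Pred (Fin m) p} → Decidable P → (f : Fin m → ℕ) →
  (∀ y → ¬ P y) ⊎ ∃ (Least P f)
min-witness {zero} P? f = inj₁ λ ()
min-witness {suc m} P? f with min-witness (P? ∘ Fin.suc) (f ∘ Fin.suc) | P? Fin.zero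
... | inj₁ none | no ¬p₀ = inj₁ λ { Fin.zero → ¬p₀ ; (Fin.suc y) → none y }
... | inj₁ none | yes p₀ =
  inj₂ (Fin.zero , p₀ , λ { {Fin.zero} _ → ℕP.≤-refl ; {Fin.suc z} pz → ⊥-elim (none z pz) })
... | inj₂ (y , py , least) | no ¬p₀ =
  inj₂ (Fin.suc y , py , λ { {Fin.zero} p₀ → ⊥-elim (¬p₀ p₀) ; {Fin.suc z} pz → least pz })
... | inj₂ (y , py , least) | yes p₀ with f Fin.zero ℕP.≤? f (Fin.suc y)
...   | yes f₀≤ =
  inj₂ (Fin.zero , p₀ , λ { {Fin.zero} _ → ℕP.≤-refl ; {Fin.suc z} pz → ℕP.≤-trans f₀≤ (least pz) })
...   | no f₀≰ =
  inj₂ (Fin.suc y , py , λ { {Fin.zero} _ → ℕP.<⇒≤ (ℕP.≰⇒> f₀≰) ; {Fin.suc z} pz → least pz })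

drop-length-++ : ∀ {A : Set} (xs ys : List A) → drop (length xs) (xs ++ ys) ≡ ys
drop-length-++ []       ys = refl
drop-length-++ (x ∷ xs) ys = drop-length-++ xs ys

∈-infectedBy : ∀ {n} {u w : Fin n} {s} (lg : RawLog n) → (u , w , s) ∈ lg → w ≢ u → (w , s) ∈ infectedBy u lg
∈-infectedBy {u = u} ((a , b , _) ∷ lg) entry w≢u with a ≟ u | b ≟ u | entry
... | yes _   | no _     | here refl    = here refl
... | yes _   | no _     | there entry′ = there (∈-infectedBy lg entry′ w≢u)
... | yes _   | yes refl | here refl    = ⊥-elim (w≢u refl)
... | yes _   | yes _    | there entry′ = ∈-infectedBy lg entry′ w≢u
... | no a≢u  | _        | here refl    = ⊥-elim (a≢u refl)
... | no _    | _        | there entry′ = ∈-infectedBy lg entry′ w≢u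

Covers : ∀ {n} → RawLog n → Set
Covers {n} lg = (w : Fin n) → Any (λ entry → proj₁ (proj₂ entry) ≡ w) lg

covers? : ∀ {n} (lg : RawLog n) → Dec (Covers lg)
covers? lg = FinP.all? (λ w → Any.any? (λ entry → proj₁ (proj₂ entry) ≟ w) lg)

module Window (δ : ℕ) where

  Active : ℤ → ℤ → Set
  Active t s = t < s × s ≤ t + + δ

  private
    pred-+ : ∀ x d → x - + 1 + d ≡ x + d - + 1
    pred-+ = solve-∀
    back-+ : ∀ x d → x - d - + 1 + d ≡ x - + 1
    back-+ = solve-∀

  active-pred⁺ : ∀ {x y} → x ≤ y → y < x + + δ → Active (x - + 1) y
  active-pred⁺ {x} x≤y y<x+δ = i≤j⇒i-1<j x≤y , subst (_ ≤_) (sym (pred-+ x (+ δ))) (i<j⇒i≤j-1 y<x+δ)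

  active-pred⁻ : ∀ {x y} → Active (x - + 1) y → x ≤ y × y < x + + δ
  active-pred⁻ {x} (p , q) = i-1<j⇒i≤j p , i≤j-1⇒i<j (subst (_ ≤_) (pred-+ x (+ δ)) q)

  active-back⁺ : ∀ {x y} → Active y x → Active (x - + δ - + 1) y
  active-back⁺ {x} (y<x , x≤y+δ) =
    i≤j⇒i-1<j (i≤j+k⇒i-k≤j (+ δ) x≤y+δ) , subst (_ ≤_) (sym (back-+ x (+ δ))) (i<j⇒i≤j-1 y<x)

  active-back⁻ : ∀ {x y} → Active (x - + δ - + 1) y → Active y x
  active-back⁻ {x} (p , q) =
    i≤j-1⇒i<j (subst (_ ≤_) (back-+ x (+ δ)) q) , i-k≤j⇒i≤j+k (+ δ) (i-1<j⇒i≤j p)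

module Transcript {n : ℕ} (E : SimpleGraph n) (Tmax δ : ℕ) where
  open Algorithm E Tmax δ

  SeededAt : Hist n → Fin n → List ℤ → Set
  SeededAt H u = All (λ t → (u , t) ∈ seeds H)

  Explored : Hist n → Fin n × ℤ → Set
  Explored H (w , s) = SeededAt H w ((s - + δ - + 1) ∷ (s - + 1) ∷ s ∷ [])

  Closed : Hist n → Round n → Set
  Closed H ((u , _) , lg) = All (Explored H) (infectedBy u lg)

  ∈-seeds-++ : ∀ (X Y : Hist n) {c} → c ∈ seeds X → c ∈ seeds (X ++ Y)
  ∈-seeds-++ X Y m = subst (_ ∈_) (sym (map-++ proj₁ X Y)) (∈-++⁺ˡ m)

  SeededAt-++ : ∀ (X Y : Hist n) {u ts} → SeededAt X u ts → SeededAt (X ++ Y) u ts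
  SeededAt-++ X Y = All.map (∈-seeds-++ X Y)

  Closed-++ : ∀ (X Y : Hist n) {r} → Closed X r → Closed (X ++ Y) r
  Closed-++ X Y = All.map (SeededAt-++ X Y)

  ClosedExtension : Hist n → Hist n → Set
  ClosedExtension H H' = Σ[ D ∈ Hist n ] H' ≡ H ++ D × All (Closed H') D

  SeedsAppended : Fin n → Hist n → List ℤ → Hist n → Set
  SeedsAppended u H ts H' =
    (Σ[ D ∈ Hist n ] H' ≡ H ++ D × All ((u ≡_) ∘ proj₁ ∘ proj₁) D) × SeededAt H' u ts

  appended-done : ∀ {u H} → SeedsAppended u H [] H
  appended-done {H = H} = ([] , sym (++-identityʳ H) , []) , []

  appended-skip : ∀ {u H t ts H'} → (u , t) ∈ seeds H → SeedsAppended u H ts H' →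
                  SeedsAppended u H (t ∷ ts) H'
  appended-skip {H = H} m ((D , refl , D-seeds) , seeded) = (D , refl , D-seeds) , ∈-seeds-++ H D m ∷ seeded

  appended-query : ∀ {u H t ts H'} lg → SeedsAppended u (H ++ ((u , t) , lg) ∷ []) ts H' →
                   SeedsAppended u H (t ∷ ts) H'
  appended-query {u} {H} {t} lg ((D , refl , D-seeds) , seeded) =
    (r ∷ D , ++-assoc H (r ∷ []) D , refl ∷ D-seeds) , ∈-seeds-++ (H ++ r ∷ []) D last ∷ seeded
    where
    r = ((u , t) , lg)
    last : (u , t) ∈ seeds (H ++ r ∷ [])
    last = subst (_ ∈_) (sym (map-++ proj₁ H (r ∷ []))) (∈-++⁺ʳ (seeds H) (here refl))

  step1-appends : ∀ {u H ts H'} → Step1 u H ts H' → SeedsAppended u H ts H'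
  step1-appends done              = appended-done
  step1-appends (skip m rest)     = appended-skip m (step1-appends rest)
  step1-appends (query _ lg rest) = appended-query lg (step1-appends rest)

  rounds-appends : ∀ {u H ts H'} → Rounds u H ts H' → SeedsAppended u H ts H'
  rounds-appends done           = appended-done
  rounds-appends (query lg rest) = appended-query lg (rounds-appends rest)

  closed-if-children-explored : ∀ {X u} (D : Hist n) → All ((u ≡_) ∘ proj₁ ∘ proj₁) D →
    All (Explored X) (children u D) → All (Closed X) D
  closed-if-children-explored []      []           _        = []
  closed-if-children-explored (r ∷ D) (refl ∷ D-seeds) explored =
    let here-explored , rest-explored = ++⁻ (infectedBy _ (proj₂ r)) explored
    in here-explored ∷ closed-if-children-explored D D-seeds rest-explored

  mutual
    explore-closed : ∀ {H c H'} → Explore H c H' → ClosedExtension H H' × Explored H' c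
    explore-closed {H} (explore step calls) with step1-appends step
    ... | (D₁ , refl , D₁-seeds) , seeded with exploreAll-closed calls
    ... | (D₂ , refl , D₂-closed) , explored =
      (D₁ ++ D₂ , ++-assoc H D₁ D₂ , ++⁺ D₁-closed D₂-closed) , SeededAt-++ (H ++ D₁) D₂ seeded
      where
      D₁-closed : All (Closed ((H ++ D₁) ++ D₂)) D₁
      D₁-closed = closed-if-children-explored D₁ D₁-seeds
                    (subst (All (Explored ((H ++ D₁) ++ D₂)) ∘ children _) (drop-length-++ H D₁) explored)

    exploreAll-closed : ∀ {H cs H'} → ExploreAll H cs H' → ClosedExtension H H' × All (Explored H') cs
    exploreAll-closed {H} [] = ([] , sym (++-identityʳ H) , []) , []
    exploreAll-closed {H} (call ∷ calls) with explore-closed call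
    ... | (D₁ , refl , D₁-closed) , explored with exploreAll-closed calls
    ... | (D₂ , refl , D₂-closed) , explored* =
      (D₁ ++ D₂ , ++-assoc H D₁ D₂ ,
       ++⁺ (All.map (λ {r} → Closed-++ (H ++ D₁) D₂ {r}) D₁-closed) D₂-closed) ,
      SeededAt-++ (H ++ D₁) D₂ explored ∷ explored*

  follow-closed : ∀ {v₀} .{{_ : NonZero δ}} {H} → FollowRun v₀ H → All (Closed H) H
  follow-closed (follow initial calls) with rounds-appends initial
  ... | (D₀ , refl , D₀-seeds) , _ with exploreAll-closed calls
  ... | (D , refl , D-closed) , explored = ++⁺ (closed-if-children-explored D₀ D₀-seeds explored) D-closed

  follow-initial-seeds : ∀ {v₀} .{{_ : NonZero δ}} {H} → FollowRun v₀ H →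
    ∀ {i} → i ℕ.< suc (ceilDiv Tmax δ) → (v₀ , + (i ℕ.* δ)) ∈ seeds H
  follow-initial-seeds (follow initial calls) i< with rounds-appends initial
  ... | (D₀ , refl , _) , seeded with exploreAll-closed calls
  ... | (D , refl , _) , _ = ∈-seeds-++ D₀ D (All.lookup seeded (∈-map⁺ _ (∈-upTo⁺ i<)))

module Process {n : ℕ} (E : SimpleGraph n) {Tmax : ℕ} (L : Labeling E Tmax) (δ : ℕ) where
  open Model E L δ
  open Window δ

  label : Fin n → Fin n → ℤ
  label u w = + lab L u w

  edge-sym : ∀ {u w} → Edge E u w → Edge E w u
  edge-sym {u} {w} e = trans (SimpleGraph.sym E w u) e

  edge-irrefl : ∀ {u w} → Edge E u w → w ≢ u
  edge-irrefl {u} e refl with trans (sym e) (SimpleGraph.irrefl E u)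
  ... | ()

  label-sym : ∀ {u w} → Edge E u w → label w u ≡ label u w
  label-sym {u} {w} e = cong +_ (sym (lab-sym L u w e))

  ActiveEdge : Fin n → ℤ → Pred (Fin n) _
  ActiveEdge v t y = Edge E v y × Active t (label v y)

  active-edge? : ∀ v t y → Dec (ActiveEdge v t y)
  active-edge? v t y = (adj E v y BoolP.≟ true) ×-dec ((t ℤP.<? label v y) ×-dec (label v y ℤP.≤? t ℤ.+ + δ))

  module _ {v t τ} (S : InfSpec v t τ) where
    private
      seed-time = proj₁ S
      infected = proj₁ (proj₂ S)

    infected-earliest : ∀ {y s s'} → y ≢ v → τ y ≡ just s → Infectable τ y s' → s ℤ.≤ s'
    infected-earliest y≢v τy = proj₂ (infected _ y≢v _ τy) _

    infectable⇒infected : ∀ {y s} → y ≢ v → Infectable τ y s → ∃[ s' ] τ y ≡ just s'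
    infectable⇒infected y≢v = proj₂ (proj₂ S) _ y≢v _

    nonseed-time : ∀ {y s} → y ≢ v → τ y ≡ just s → ∃[ k ] s ≡ + k
    nonseed-time y≢v τy with proj₁ (infected _ y≢v _ τy)
    ... | _ , _ , _ , _ , _ , _ , refl = _ , refl

    data Infector (y : Fin n) (k : ℕ) : Set where
      by-seed    : ActiveEdge v t y → lab L v y ≡ k → Infector y k
      by-nonseed : ∀ {x k'} → x ≢ v → τ x ≡ just (+ k') → Edge E x y → lab L x y ≡ k →
                   Active (+ k') (+ k) → Infector y k

    infector : ∀ {y k} → y ≢ v → τ y ≡ just (+ k) → Infector y k
    infector y≢v τy with proj₁ (infected _ y≢v _ τy)
    ... | x , s , τx , s<k , k≤s+δ , exy , refl with x ≟ v
    ...   | yes refl with trans (sym τx) seed-time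
    ...     | refl = by-seed (exy , s<k , k≤s+δ) refl
    infector y≢v τy | x , s , τx , s<k , k≤s+δ , exy , refl | no x≢v with nonseed-time x≢v τx
    ...     | _ , refl = by-nonseed x≢v τx exy refl (s<k , k≤s+δ)

    infection-edge : ∀ {y k} → y ≢ v → τ y ≡ just (+ k) → ∃[ z ] Edge E y z × lab L y z ≡ k
    infection-edge y≢v τy with proj₁ (infected _ y≢v _ τy)
    ... | x , _ , _ , _ , _ , exy , refl = x , edge-sym exy , sym (lab-sym L x _ exy)

    infected-not-before-first-active : ∀ {ℓ} → (∀ {y} → ActiveEdge v t y → ℓ ℕ.≤ lab L v y) →
      ∀ k {y} → y ≢ v → τ y ≡ just (+ k) → ℓ ℕ.≤ k
    infected-not-before-first-active {ℓ} first = <-rec _ step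
      where
      step : ∀ k → (∀ {j} → j ℕ.< k → ∀ {y} → y ≢ v → τ y ≡ just (+ j) → ℓ ℕ.≤ j) →
             ∀ {y} → y ≢ v → τ y ≡ just (+ k) → ℓ ℕ.≤ k
      step k earlier y≢v τy with infector y≢v τy
      ... | by-seed active refl = first active
      ... | by-nonseed x≢v τx _ _ (k'<k , _) =
        ℕP.<⇒≤ (ℕP.≤-<-trans (earlier (ℤP.drop‿+<+ k'<k) x≢v τx) (ℤP.drop‿+<+ k'<k))

  first-active-edge-logged : ∀ {u t' lg w} → Consistent (u , t') lg → Least (ActiveEdge u t') (lab L u) w →
    (u , w , label u w) ∈ lg
  first-active-edge-logged {u} {t'} {w = w} (τ , S , par , par-infects , _ , logged)
                           ((euw , t'<ℓ , ℓ≤t'+δ) , first) =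
    logged u w ℓ (inj₂ (w≢u , τw , sym parent))
    where
    ℓ = label u w
    w≢u = edge-irrefl euw
    not-before : ∀ k {y} → y ≢ u → τ y ≡ just (+ k) → lab L u w ℕ.≤ k
    not-before = infected-not-before-first-active S first
    by-u : Infectable τ w ℓ
    by-u = u , t' , proj₁ S , t'<ℓ , ℓ≤t'+δ , euw , refl
    τw : τ w ≡ just ℓ
    τw with infectable⇒infected S w≢u by-u
    ... | _ , τw′ with nonseed-time S w≢u τw′
    ...   | k , refl = subst (λ k → τ w ≡ just (+ k)) k≡ℓ τw′
      where
      k≡ℓ : k ≡ lab L u w
      k≡ℓ = ℕP.≤-antisym (ℤP.drop‿+≤+ (infected-earliest S w≢u τw′ by-u)) (not-before k w≢u τw′)
    parent : par w ≡ u
    parent with par w ≟ u | par-infects w w≢u ℓ τw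
    ... | yes p≡u | _ = p≡u
    ... | no p≢u | s , τp , s<ℓ , _ with nonseed-time S p≢u τp
    ...   | kp , refl = ⊥-elim (ℕP.<⇒≱ (ℤP.drop‿+<+ s<ℓ) (not-before kp p≢u τp))

  AgreeAt : Fin n → (τ τ' : Fin n → Maybe ℤ) → ℕ → Set
  AgreeAt v τ τ' k =
    ∀ {u} → u ≢ v → (τ u ≡ just (+ k) → τ' u ≡ just (+ k)) × (τ' u ≡ just (+ k) → τ u ≡ just (+ k))

  module _ {v t t' τ τ' k} (S : InfSpec v t τ) (S' : InfSpec v t' τ') (active⊆ : ActiveEdge v t ⊆ ActiveEdge v t')
           (earlier : ∀ {j} → j ℕ.< k → AgreeAt v τ τ' j) where

    infectable-transfer : ∀ {u} → u ≢ v → τ u ≡ just (+ k) → Infectable τ' u (+ k)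
    infectable-transfer u≢v τu with infector S u≢v τu
    ... | by-seed active refl =
      let evu , t'<k , k≤t'+δ = active⊆ active in v , t' , proj₁ S' , t'<k , k≤t'+δ , evu , refl
    ... | by-nonseed x≢v τx exu refl (k'<k , k≤k'+δ) =
      _ , _ , proj₁ (earlier (ℤP.drop‿+<+ k'<k) x≢v) τx , k'<k , k≤k'+δ , exu , refl

    agree-step : ∀ {u} → u ≢ v → τ u ≡ just (+ k) → τ' u ≡ just (+ k)
    agree-step u≢v τu with infectable⇒infected S' u≢v (infectable-transfer u≢v τu)
    ... | _ , τ'u with nonseed-time S' u≢v τ'u
    ...   | k₂ , refl with ℕP.m≤n⇒m<n∨m≡n (ℤP.drop‿+≤+ (infected-earliest S' u≢v τ'u (infectable-transfer u≢v τu)))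
    ...     | inj₂ refl = τ'u
    ...     | inj₁ k₂<k = ⊥-elim (ℕP.<⇒≢ k₂<k (ℤP.+-injective (just-injective same-time)))
      where
      same-time : just (+ k₂) ≡ just (+ k)
      same-time = trans (sym (proj₂ (earlier k₂<k u≢v) τ'u)) τu

  same-window-agree : ∀ {v t t' τ τ'} → InfSpec v t τ → InfSpec v t' τ' → ActiveEdge v t ≐ ActiveEdge v t' →
    ∀ {u s} → u ≢ v → τ u ≡ just s → τ' u ≡ just s
  same-window-agree {v} {τ = τ} {τ'} S S' (⊆′ , ⊇′) u≢v τu with nonseed-time S u≢v τu
  ... | k , refl = proj₁ (<-rec (AgreeAt v τ τ') step k u≢v) τu
    where
    step : ∀ k → (∀ {j} → j ℕ.< k → AgreeAt v τ τ' j) → AgreeAt v τ τ' k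
    step k earlier u≢v =
      agree-step S S' ⊆′ earlier u≢v ,
      agree-step S' S ⊇′ (λ j<k u≢v → let to , from = earlier j<k u≢v in from , to) u≢v

  covering-log⇒IPZ : ∀ {u t lg} → Consistent (u , t) lg → Covers lg → IPZ u t
  covering-log⇒IPZ {t = t} (τ , S , _ , _ , sound , _) covers = τ , S , total
    where
    total : ∀ w → ∃[ s ] τ w ≡ just s
    total w with find (covers w)
    ... | (a , _ , s) , mem , refl with sound a w s mem
    ...   | inj₁ (_ , refl , _) = t , proj₁ S
    ...   | inj₂ (_ , τw , _) = s , τw

  same-window-covers : ∀ {v t t' lg} → IPZ v t → Consistent (v , t') lg →
    ActiveEdge v t ≐ ActiveEdge v t' → Covers lg
  same-window-covers {v} (τ , S , total) (τ' , S' , par , _ , _ , logged) same w with w ≟ v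
  ... | yes refl = lose (logged w w _ (inj₁ (refl , refl , refl))) refl
  ... | no w≢v with total w
  ...   | s , τw = lose (logged (par w) w s (inj₂ (w≢v , same-window-agree S S' same w≢v τw , refl))) refl

module SeedWindows {n : ℕ} (E : SimpleGraph n) {Tmax : ℕ} (L : Labeling E Tmax) (δ : ℕ) where
  open Window δ
  open Process E L δ

  LateEdge : Fin n → ℤ → ℤ → Pred (Fin n) _
  LateEdge v t a y = Edge E v y × t + + δ < label v y × label v y < a + + δ

  late-edge? : ∀ v t a → Decidable (LateEdge v t a)
  late-edge? v t a y = (adj E v y BoolP.≟ true) ×-dec ((t + + δ ℤP.<? label v y) ×-dec (label v y ℤP.<? a + + δ))

  module _ {v t ya} (first : Least (ActiveEdge v t) (lab L v) ya) where
    private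
      a = label v ya
      t<a = proj₁ (proj₂ (proj₁ first))

    window-after-first : (∀ y → ¬ LateEdge v t a y) → ActiveEdge v t ≐ ActiveEdge v (a - + 1)
    window-after-first no-late = ⊆′ , ⊇′
      where
      ⊆′ : ActiveEdge v t ⊆ ActiveEdge v (a - + 1)
      ⊆′ active@(e , _ , ℓ≤t+δ) =
        e , active-pred⁺ (+≤+ (proj₂ first active)) (ℤP.≤-<-trans ℓ≤t+δ (ℤP.+-monoˡ-< (+ δ) t<a))
      ⊇′ : ActiveEdge v (a - + 1) ⊆ ActiveEdge v t
      ⊇′ {y} (e , window) with active-pred⁻ window | label v y ℤP.≤? t + + δ
      ... | a≤ℓ , _    | yes ℓ≤t+δ = e , ℤP.<-≤-trans t<a a≤ℓ , ℓ≤t+δ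
      ... | _ , ℓ<a+δ | no ℓ≰t+δ  = ⊥-elim (no-late y (e , ℤP.≰⇒> ℓ≰t+δ , ℓ<a+δ))

    window-before-late : ∀ {yb} → Least (LateEdge v t a) (lab L v) yb →
      ActiveEdge v t ≐ ActiveEdge v (label v yb - + δ - + 1)
    window-before-late {yb} ((_ , t+δ<b , b<a+δ) , least-late) = ⊆′ , ⊇′
      where
      b = label v yb
      ⊆′ : ActiveEdge v t ⊆ ActiveEdge v (b - + δ - + 1)
      ⊆′ active@(e , _ , ℓ≤t+δ) =
        e , active-back⁺ (ℤP.≤-<-trans ℓ≤t+δ t+δ<b ,
                          ℤP.<⇒≤ (ℤP.<-≤-trans b<a+δ (ℤP.+-monoˡ-≤ (+ δ) (+≤+ (proj₂ first active)))))
      ⊇′ : ActiveEdge v (b - + δ - + 1) ⊆ ActiveEdge v t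
      ⊇′ {y} (e , window) with active-back⁻ window | label v y ℤP.≤? t + + δ
      ... | ℓ<b , b≤ℓ+δ | yes ℓ≤t+δ = e , +-cancelʳ-< (+ δ) (ℤP.<-≤-trans t+δ<b b≤ℓ+δ) , ℓ≤t+δ
      ... | ℓ<b , _     | no ℓ≰t+δ  =
        ⊥-elim (ℤP.<⇒≱ ℓ<b (+≤+ (least-late (e , ℤP.≰⇒> ℓ≰t+δ , ℤP.<-trans ℓ<b b<a+δ))))

module Discovery {n : ℕ} (E : SimpleGraph n) (Tmax δ : ℕ) .{{_ : NonZero δ}} (L : Labeling E Tmax)
  {v₀ : Fin n} {H : Hist n} (run : Algorithm.FollowRun E Tmax δ v₀ H)
  (consistent : All (λ r → Model.Consistent E L δ (proj₁ r) (proj₂ r)) H) where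
  open Model E L δ
  open Window δ
  open Transcript E Tmax δ
  open Process E L δ
  open SeedWindows E L δ

  consistent-round : ∀ {c} → c ∈ seeds H → ∃[ lg ] (c , lg) ∈ H × Consistent c lg
  consistent-round seeded with ∈-map⁻ proj₁ seeded
  ... | (_ , lg) , mem , refl = lg , mem , All.lookup consistent mem

  logged⇒explored : ∀ {u t' lg w s} → ((u , t') , lg) ∈ H → (u , w , s) ∈ lg → w ≢ u → Explored H (w , s)
  logged⇒explored {lg = lg} mem entry w≢u =
    All.lookup (All.lookup (follow-closed run) mem) (∈-infectedBy lg entry w≢u)

  first-active-explored : ∀ {u t' w} → (u , t') ∈ seeds H → Least (ActiveEdge u t') (lab L u) w →
    Explored H (w , label u w)
  first-active-explored seeded first with consistent-round seeded
  ... | _ , mem , cons = logged⇒explored mem (first-active-edge-logged cons first) (edge-irrefl (proj₁ (proj₁ first)))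

  -- The round seeded at ℓ - 1 has no edge active before ℓ, so it must log the infection at ℓ.
  explored-across : ∀ {u w} → Edge E u w → Explored H (w , label u w) → Explored H (u , label u w)
  explored-across {u} {w} euw (_ ∷ seeded ∷ _ ∷ []) =
    subst (λ ℓ → Explored H (u , ℓ)) (label-sym euw) (first-active-explored seeded (active , least))
    where
    ℓ = label u w
    active : ActiveEdge w (ℓ - + 1) u
    active = edge-sym euw , subst (Active (ℓ - + 1)) (sym (label-sym euw))
      (active-pred⁺ ℤP.≤-refl (+<+ (ℕP.m<m+n (lab L u w) (>-nonZero⁻¹ δ))))
    least : ∀ {y} → ActiveEdge w (ℓ - + 1) y → lab L w u ℕ.≤ lab L w y
    least {y} (_ , ℓ-1<ℓ′ , _) =
      subst (ℕ._≤ lab L w y) (ℤP.+-injective (sym (label-sym euw))) (ℤP.drop‿+≤+ (i-1<j⇒i≤j ℓ-1<ℓ′))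

  EarlierActive : Fin n → ℤ → ℤ → Pred (Fin n) _
  EarlierActive u t' ℓ y = ActiveEdge u t' y × label u y < ℓ

  earlier-active? : ∀ u t' ℓ → Decidable (EarlierActive u t' ℓ)
  earlier-active? u t' ℓ y = active-edge? u t' y ×-dec (label u y ℤP.<? ℓ)

  -- Induction on a bound m for ℓ - t': both recursive calls shrink this gap.
  propagate-within : ∀ m {u t' w} → (u , t') ∈ seeds H → ActiveEdge u t' w → label u w ≤ t' + + m →
    Explored H (u , label u w) × Explored H (w , label u w)
  propagate-within zero {t' = t'} _ (_ , t'<ℓ , _) ℓ≤t'+0 =
    ⊥-elim (ℤP.<⇒≱ t'<ℓ (subst (_ ≤_) (ℤP.+-identityʳ t') ℓ≤t'+0))
  propagate-within (suc m) {u} {t'} {w} seeded active@(euw , _ , ℓ≤t'+δ) ℓ≤t'+m+1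
    with FinP.any? (earlier-active? u t' (label u w))
  ... | no none =
    explored-across euw explored-w , explored-w
    where
    explored-w = first-active-explored seeded
      (active , λ {y} active-y → ℤP.drop‿+≤+ (ℤP.≮⇒≥ (λ r<ℓ → none (y , active-y , r<ℓ))))
  ... | yes (y , active-y@(_ , t'<r , _) , r<ℓ)
    with propagate-within m seeded active-y (i<j+suc[m]⇒i≤j+m {j = t'} {m} (ℤP.<-≤-trans r<ℓ ℓ≤t'+m+1))
  ...   | (_ ∷ _ ∷ seeded-r ∷ []) , _ =
    propagate-within m seeded-r
      (euw , r<ℓ , ℤP.≤-trans ℓ≤t'+δ (ℤP.+-monoˡ-≤ (+ δ) (ℤP.<⇒≤ t'<r)))
      (ℤP.≤-trans ℓ≤t'+m+1 (i<j⇒i+suc[m]≤j+m m t'<r))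

  propagate : ∀ {u t' w} → (u , t') ∈ seeds H → ActiveEdge u t' w →
    Explored H (u , label u w) × Explored H (w , label u w)
  propagate seeded active = propagate-within δ seeded active (proj₂ (proj₂ active))

  initial-explored : ∀ {w} → Edge E v₀ w → Explored H (v₀ , label v₀ w)
  initial-explored {w} e with initial-window (lab-pos L v₀ w e) (lab-life L v₀ w e)
  ... | _ , i< , iδ<ℓ , ℓ≤iδ+δ =
    proj₁ (propagate (follow-initial-seeds run i<) (e , +<+ iδ<ℓ , +≤+ ℓ≤iδ+δ))

  module _ {v t τ} (S : InfSpec v t τ) (total : ∀ w → ∃[ s ] τ w ≡ just s) where

    ExploredActiveEdge : Set
    ExploredActiveEdge = ∃[ y ] ActiveEdge v t y × Explored H (v , label v y)

    chain-explored : ∀ k {y} → y ≢ v → τ y ≡ just (+ k) → Explored H (y , + k) → ExploredActiveEdge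
    chain-explored = <-rec _ step
      where
      step : ∀ k →
        (∀ {j} → j ℕ.< k → ∀ {y} → y ≢ v → τ y ≡ just (+ j) → Explored H (y , + j) → ExploredActiveEdge) →
        ∀ {y} → y ≢ v → τ y ≡ just (+ k) → Explored H (y , + k) → ExploredActiveEdge
      step k earlier {y} y≢v τy explored with infector S y≢v τy
      ... | by-seed active refl = y , active , explored-across (proj₁ active) explored
      ... | by-nonseed x≢v τx exy refl window with infection-edge S x≢v τx
      ...   | _ , exz , refl with explored-across exy explored
      ...     | seeded-back ∷ _ =
        earlier (ℤP.drop‿+<+ (proj₁ window)) x≢v τx (proj₁ (propagate seeded-back (exz , active-back⁺ window)))

    -- The initial rounds explore v₀ at its infection time; its infection chain leads back to v.
    some-active-explored : ∃ (ActiveEdge v t) → ExploredActiveEdge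
    some-active-explored (y , active) with v₀ ≟ v
    ... | yes refl = y , active , initial-explored (proj₁ active)
    ... | no v₀≢v with total v₀
    ...   | _ , τv₀ with nonseed-time S v₀≢v τv₀
    ...     | k , refl with infection-edge S v₀≢v τv₀
    ...       | _ , ev₀z , refl = chain-explored k v₀≢v τv₀ (initial-explored ev₀z)

    seed-explored-at-first-active : ∀ {ya} → Least (ActiveEdge v t) (lab L v) ya → ExploredActiveEdge →
      Explored H (v , label v ya)
    seed-explored-at-first-active ((eva , t<a , _) , least)
                                  (_ , active-y@(_ , _ , b≤t+δ) , explored-y@(seeded-back ∷ _))
      with ℕP.m≤n⇒m<n∨m≡n (least active-y)
    ... | inj₂ a≡b = subst (λ ℓ → Explored H (v , + ℓ)) (sym a≡b) explored-y
    ... | inj₁ a<b = proj₁ (propagate seeded-back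
          (eva , active-back⁺ (+<+ a<b , ℤP.≤-trans b≤t+δ (ℤP.+-monoˡ-≤ (+ δ) (ℤP.<⇒≤ t<a)))))

    only-seed : (∀ y → ¬ ActiveEdge v t y) → ∀ y → y ≡ v
    only-seed none y with y ≟ v
    ... | yes y≡v = y≡v
    ... | no y≢v with total y
    ...   | _ , τy with nonseed-time S y≢v τy
    ...     | k , refl = ⊥-elim (ℕP.<-irrefl refl
                  (infected-not-before-first-active S {suc k} (λ active → ⊥-elim (none _ active)) k y≢v τy))

    -- With a the first label active for t, the seed a - 1 sees the same edges of v unless some label lies
    -- in (t + δ , a + δ); then for the least such label b, the seed b - δ - 1 does.
    same-window-seed : ∃[ t' ] (v , t') ∈ seeds H × ActiveEdge v t ≐ ActiveEdge v t'
    same-window-seed with min-witness (active-edge? v t) (lab L v)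
    ... | inj₁ none =
      + 0 , subst (λ u → (u , + 0) ∈ seeds H) (only-seed none v₀) (follow-initial-seeds run (s≤s z≤n)) ,
      (λ active → ⊥-elim (none _ active)) , (λ {y} (e , _) → ⊥-elim (edge-irrefl e (only-seed none y)))
    ... | inj₂ (ya , first) with seed-explored-at-first-active first (some-active-explored (ya , proj₁ first))
                               | min-witness (late-edge? v t (label v ya)) (lab L v)
    ...   | _ ∷ seeded-pred ∷ _ ∷ [] | inj₁ no-late = _ , seeded-pred , window-after-first first no-late
    ...   | _ ∷ _ ∷ seeded-a ∷ []    | inj₂ (_ , late@((evb , t+δ<b , b<a+δ) , _)) =
      _ , All.head (proj₁ (propagate seeded-a (evb , a<b , ℤP.<⇒≤ b<a+δ))) , window-before-late first late
      where
      a<b = ℤP.≤-<-trans (proj₂ (proj₂ (proj₁ first))) t+δ<b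

  IPZ⇒covering-round : ∀ {v t} → IPZ v t → Any (Covers ∘ proj₂) H
  IPZ⇒covering-round ipz@(_ , S , total) with same-window-seed S total
  ... | _ , seeded , same with consistent-round seeded
  ...   | lg , mem , cons = lose mem (same-window-covers ipz cons same)

decide : ∀ {n} → Hist n → Maybe (Fin n × ℤ)
decide H with Any.any? (covers? ∘ proj₂) H
... | yes covering = just (proj₁ (proj₁ (find covering)))
... | no _         = nothing

theorem2 : (n : ℕ) (E : SimpleGraph n) (Tmax δ : ℕ) .{{_ : NonZero δ}} (v₀ : Fin n) →
    Σ (Hist n → Maybe (Fin n × ℤ)) λ decide →
      ∀ (H : Hist n) → Algorithm.FollowRun E Tmax δ v₀ H →
      ∀ (L : Labeling E Tmax) →
      All (λ r → Model.Consistent E L δ (proj₁ r) (proj₂ r)) H →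
      Model.Wins E L δ (decide H)
theorem2 n E Tmax δ v₀ = decide , correct
  where
  correct : ∀ H → Algorithm.FollowRun E Tmax δ v₀ H → ∀ L →
    All (λ r → Model.Consistent E L δ (proj₁ r) (proj₂ r)) H → Model.Wins E L δ (decide H)
  correct H run L consistent with Any.any? (covers? ∘ proj₂) H
  ... | yes covering =
    let _ , mem , covers = find covering
    in Process.covering-log⇒IPZ E L δ (All.lookup consistent mem) covers
  ... | no none = λ (_ , _ , ipz) → none (Discovery.IPZ⇒covering-round E Tmax δ L run consistent ipz)
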